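{- Fix one of the types $\mathrm{B},\mathrm{C},\mathrm{D}$ and let $w\in W$. If $w\in S_\infty$ then $\mathfrak{S}_w(z,t;0)=\mathfrak{S}^A_w(z,t)$; otherwise $\mathfrak{S}_w(z,t;0)=0$.
   Context: $t,z,x$ infinite sequences of indeterminates; $Q_k(x)$ defined by $\prod_i\frac{1+x_iu}{1-x_iu}=\sum_kQ_k(x)u^k$, $P_k=\tfrac12Q_k$, $\Gamma=\mathbb{Z}[Q_1,\dots]$, $\Gamma'=\mathbb{Z}[P_1,\dots]$. Type C: $R=\mathbb{Z}[t]\otimes\mathbb{Z}[z]\otimes\Gamma$; types B, D: $R=\mathbb{Z}[t]\otimes\mathbb{Z}[z]\otimes\Gamma'$ (grading $\deg t_i=\deg z_i=1$, $\deg Q_k=\deg P_k=k$). $W_\infty$: finitely supported signed permutations of $\{1,2,\dots\}$, Coxeter on $s_0=(1,\bar1)$, $s_i=(i,i+1)(\bar i,\overline{i+1})$; $W'_\infty$: subgroup with even number of sign changes, Coxeter on $s_{\hat1}=s_0s_1s_0,s_1,\dots$. Types B, C: $W=W_\infty$, $I=\{0,1,\dots\}$; type D: $W=W'_\infty$, $I=\{\hat1,1,\dots\}$. $S_\infty\subset W$ is the subgroup generated by $s_1,s_2,\dots$. Actions on $R$: $s_i^z$ ($i\ge1$) swaps $z_i,z_{i+1}$; $s_0^z$: $z_1\mapsto-z_1$, $\varphi(x)\mapsto\varphi(z_1,x_1,\dots)$; $s_i^t$ swaps $t_i,t_{i+1}$; $s_0^t$: $t_1\mapsto-t_1$, $\varphi(x)\mapsto\varphi(-t_1,x_1,\dots)$;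 $s_{\hat1}^z=s_0^zs_1^zs_0^z$, $s_{\hat1}^t=s_0^ts_1^ts_0^t$. Roots $\alpha_i=t_{i+1}-t_i$ ($i\ge1$), $\alpha_0=t_1$ (B), $2t_1$ (C), $\alpha_{\hat1}=t_1+t_2$ (D). $\omega$: involution $z_i\mapsto-t_i$, $t_i\mapsto-z_i$, fixing $\Gamma'$. $\partial_if=(f-s_i^zf)/\omega(\alpha_i)$, $\delta_if=(f-s_i^tf)/\alpha_i$. Double Schubert polynomials $\{\mathfrak{S}_w\}_{w\in W}$: unique elements of $R$ with $\partial_i\mathfrak{S}_w=\mathfrak{S}_{ws_i}$ if $\ell(ws_i)<\ell(w)$ else $0$, $\delta_i\mathfrak{S}_w=\mathfrak{S}_{s_iw}$ if $\ell(s_iw)<\ell(w)$ else $0$, $\mathfrak{S}_e=1$, zero constant term for $w\ne e$. $\mathfrak{S}_w(z,t;0)$ is the image under the $\mathbb{Z}[z,t]$-algebra map $R\to\mathbb{Z}[z,t]$, $\varphi(x)\mapsto\varphi(0,0,\dots)$. Type A double Schubert polynomials $\{\mathfrak{S}^A_w(z,t)\}_{w\in S_\infty}$: the unique family in $\mathbb{Z}[z,t]$ with $\partial_i\mathfrak{S}^A_w=\mathfrak{S}^A_{ws_i}$ if $\ell(ws_i)<\ell(w)$ else $0$, $\delta_i\mathfrak{S}^A_w=\mathfrak{S}^A_{s_iw}$ if $\ell(s_iw)<\ell(w)$ else $0$, for $i\ge1$ (here $\partial_if=(f-s_i^zf)/(z_i-z_{i+1})$, $\delta_if=(f-s_i^tf)/(t_{i+1}-t_i)$),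 $\mathfrak{S}^A_e=1$ and zero constant term for $w\ne e$. -}

module Defs where

open import Data.Bool using (Bool; true; false; if_then_else_; _∧_; _∨_)
open import Data.Nat as ℕ using (ℕ; zero; suc; _∸_; _≡ᵇ_; _≤_; _<_)
open import Data.Integer as ℤ using (ℤ; +_; -[1+_]; 0ℤ; 1ℤ; ∣_∣)
open import Data.List using (List; []; _∷_; _++_; [_]; map; concatMap; upTo; drop; foldr; length)
open import Data.Product using (Σ; _×_; _,_; proj₁; proj₂)
open import Relation.Binary.PropositionalEquality using (_≡_)
open import Relation.Nullary using (¬_)

-- Formal power series in the variables t₁,t₂,…, z₁,z₂,…, x₁,x₂,… over ℤ.
-- A monomial is given by three exponent lists (position 0 ↦ index 1);
-- trailing zeros are immaterial (every series built below ignores them).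

Series : Set
Series = List ℕ → List ℕ → List ℕ → ℤ

infix 4 _≈_
_≈_ : Series → Series → Set
f ≈ g = ∀ a b c → f a b c ≡ g a b c

allZero : List ℕ → Bool
allZero []      = true
allZero (e ∷ l) = (e ≡ᵇ 0) ∧ allZero l

sumL : List ℕ → ℕ
sumL = foldr ℕ._+_ 0

nz : List ℕ → ℕ
nz []            = 0
nz (zero ∷ l)    = nz l
nz (suc _ ∷ l)   = suc (nz l)

sumℤ : List ℤ → ℤ
sumℤ = foldr ℤ._+_ 0ℤ

sgn : ℕ → ℤ
sgn zero    = 1ℤ
sgn (suc n) = ℤ.- sgn n

get : List ℕ → ℕ → ℕ
get []      _       = 0
get (e ∷ l) zero    = e
get (e ∷ l) (suc k) = get l k

set : List ℕ → ℕ → ℕ → List ℕ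
set []      zero    v = v ∷ []
set []      (suc k) v = 0 ∷ set [] k v
set (e ∷ l) zero    v = v ∷ l
set (e ∷ l) (suc k) v = e ∷ set l k v

swapL : List ℕ → ℕ → ℕ → List ℕ
swapL l p q = set (set l p (get l q)) q (get l p)

splits : List ℕ → List (List ℕ × List ℕ)
splits []      = ([] , []) ∷ []
splits (e ∷ l) = concatMap (λ j → map (λ pq → (j ∷ proj₁ pq , (e ∸ j) ∷ proj₂ pq)) (splits l)) (upTo (suc e))

constS : ℤ → Series
constS n a b c = if allZero a ∧ allZero b ∧ allZero c then n else 0ℤ

oneS zeroS : Series
oneS  = constS 1ℤ
zeroS = constS 0ℤ

infixl 6 _⊕_ _⊖_
infixl 7 _⊛_
_⊕_ _⊖_ _⊛_ : Series → Series → Series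
(f ⊕ g) a b c = f a b c ℤ.+ g a b c
(f ⊖ g) a b c = f a b c ℤ.- g a b c
(f ⊛ g) a b c =
  sumℤ (concatMap (λ sa → concatMap (λ sb → map (λ sc →
     f (proj₁ sa) (proj₁ sb) (proj₁ sc) ℤ.* g (proj₂ sa) (proj₂ sb) (proj₂ sc))
     (splits c)) (splits b)) (splits a))

negS : Series → Series
negS f a b c = ℤ.- f a b c

-- isUnit k l : l is the exponent list of the single variable with index k+1
isUnit : ℕ → List ℕ → Bool
isUnit zero    (1 ∷ l)    = allZero l
isUnit (suc k) (0 ∷ l)    = isUnit k l
isUnit (suc k) []         = false
isUnit _       _          = false

-- tv k = t_{k+1},  zv k = z_{k+1}
tv zv : ℕ → Series
tv k a b c = if isUnit k a ∧ allZero b ∧ allZero c then 1ℤ else 0ℤ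
zv k a b c = if allZero a ∧ isUnit k b ∧ allZero c then 1ℤ else 0ℤ

-- Q_k(x): ∏ (1+x_i u)/(1-x_i u) = ∏ (1 + 2 Σ_{m≥1} x_i^m u^m), so the
-- coefficient of x^c in Q_k is 2^{#nonzero parts of c} when |c| = k.
Qs : ℕ → Series
Qs k a b c = if allZero a ∧ allZero b ∧ (sumL c ≡ᵇ k) then + (2 ℕ.^ nz c) else 0ℤ

-- P_k = Q_k / 2  (k ≥ 1)
Ps : ℕ → Series
Ps k a b c = if allZero a ∧ allZero b ∧ (sumL c ≡ᵇ k) then + (2 ℕ.^ (nz c ∸ 1)) else 0ℤ

data Typ : Set where
  B C D : Typ

gamGen : Typ → ℕ → Series
gamGen B = Ps
gamGen C = Qs
gamGen D = Ps

-- R = ℤ[t] ⊗ ℤ[z] ⊗ Γ (type C), resp. ⊗ Γ' (types B, D), as the subring of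
-- power series generated by the t_i, z_i and Q_k (resp. P_k), k ≥ 1.
data InR (T : Typ) : Series → Set where
  cst : ∀ n → InR T (constS n)
  tV  : ∀ k → InR T (tv k)
  zV  : ∀ k → InR T (zv k)
  gV  : ∀ k → InR T (gamGen T (suc k))
  add : ∀ {f g} → InR T f → InR T g → InR T (f ⊕ g)
  mul : ∀ {f g} → InR T f → InR T g → InR T (f ⊛ g)
  ext : ∀ {f g} → f ≈ g → InR T g → InR T f

data InPoly : Series → Set where
  cst : ∀ n → InPoly (constS n)
  tV  : ∀ k → InPoly (tv k)
  zV  : ∀ k → InPoly (zv k)
  add : ∀ {f g} → InPoly f → InPoly g → InPoly (f ⊕ g)
  mul : ∀ {f g} → InPoly f → InPoly g → InPoly (f ⊛ g)
  ext : ∀ {f g} → f ≈ g → InPoly g → InPoly f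

-- swapZ k = s_{k+1}^z , swapT k = s_{k+1}^t
swapZ swapT : ℕ → Series → Series
swapZ k f a b c = f a (swapL b k (suc k)) c
swapT k f a b c = f (swapL a k (suc k)) b c

-- s_0^z : z₁ ↦ -z₁, φ(x) ↦ φ(z₁, x₁, x₂, …)
s0z : Series → Series
s0z f a b c = sumℤ (map (λ j → sgn (get b 0 ∸ j) ℤ.* f a ((get b 0 ∸ j) ∷ drop 1 b) (j ∷ c))
                        (upTo (suc (get b 0))))

-- s_0^t : t₁ ↦ -t₁, φ(x) ↦ φ(-t₁, x₁, x₂, …)
s0t : Series → Series
s0t f a b c = sgn (get a 0) ℤ.* sumℤ (map (λ j → f ((get a 0 ∸ j) ∷ drop 1 a) b (j ∷ c))
                                         (upTo (suc (get a 0))))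

-- Generator indices i : ℕ.  i ≥ 1 is s_i.  i = 0 is s_0 in types B, C
-- and s_{1̂} = s_0 s_1 s_0 in type D.
sz st : Typ → ℕ → Series → Series
sz D zero f    = s0z (swapZ 0 (s0z f))
sz _ zero f    = s0z f
sz _ (suc k) f = swapZ k f
st D zero f    = s0t (swapT 0 (s0t f))
st _ zero f    = s0t f
st _ (suc k) f = swapT k f

alpha : Typ → ℕ → Series
alpha B zero    = tv 0
alpha C zero    = tv 0 ⊕ tv 0
alpha D zero    = tv 0 ⊕ tv 1
alpha _ (suc k) = tv (suc k) ⊖ tv k

-- ω : z_i ↦ -t_i, t_i ↦ -z_i, fixing Γ'
omegaS : Series → Series
omegaS f a b c = sgn (sumL a ℕ.+ sumL b) ℤ.* f b a c

spec : Series → Series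
spec f a b c = if allZero c then f a b [] else 0ℤ

-- The groups, via words in the generators (a word [i₁,…,iₘ] is s_{i₁}⋯s_{iₘ}),
-- realised as signed permutations of ℤ (x ↦ -x symmetric).

swN : ℕ → ℕ → ℕ
swN m n = if n ≡ᵇ m then suc m else (if n ≡ᵇ suc m then m else n)

mapAbs : (ℕ → ℕ) → ℤ → ℤ
mapAbs f (+ n)      = + f n
mapAbs f -[1+ n ]   = ℤ.- (+ f (suc n))

genAct : Typ → ℕ → ℤ → ℤ
genAct D zero    x = if (∣ x ∣ ≡ᵇ 1) ∨ (∣ x ∣ ≡ᵇ 2) then ℤ.- mapAbs (swN 1) x else x
genAct _ zero    x = if ∣ x ∣ ≡ᵇ 1 then ℤ.- x else x
genAct _ (suc k) x = mapAbs (swN (suc k)) x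

actW : Typ → List ℕ → ℤ → ℤ
actW T []      x = x
actW T (i ∷ w) x = genAct T i (actW T w x)

Equiv : Typ → List ℕ → List ℕ → Set
Equiv T w w' = ∀ x → actW T w x ≡ actW T w' x

IsLen : Typ → List ℕ → ℕ → Set
IsLen T w n = Σ (List ℕ) (λ w' → Equiv T w' w × length w' ≡ n)
            × (∀ w' → Equiv T w' w → n ≤ length w')

-- Type A: words in s₁, s₂, …; the letter k stands for s_{k+1}.
EquivA : List ℕ → List ℕ → Set
EquivA u u' = Equiv B (map suc u) (map suc u')

IsLenA : List ℕ → ℕ → Set
IsLenA u n = Σ (List ℕ) (λ u' → EquivA u' u × length u' ≡ n)
           × (∀ u' → EquivA u' u → n ≤ length u')

-- Characterising properties.  "∂_i f = g" is written f - s_i f = ω(α_i) g,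
-- which is equivalent since the power series ring is a domain.

record IsDoubleSchubert (T : Typ) (S : List ℕ → Series) : Set where
  field
    inR      : ∀ w → InR T (S w)
    wellDef  : ∀ w w' → Equiv T w w' → S w ≈ S w'
    unit     : S [] ≈ oneS
    constTm  : ∀ w → ¬ Equiv T w [] → S w [] [] [] ≡ 0ℤ
    partial  : ∀ w i m n → IsLen T w n → IsLen T (w ++ [ i ]) m →
                 (m < n → S w ⊖ sz T i (S w) ≈ omegaS (alpha T i) ⊛ S (w ++ [ i ]))
               × (n < m → S w ≈ sz T i (S w))
    delta    : ∀ w i m n → IsLen T w n → IsLen T (i ∷ w) m →
                 (m < n → S w ⊖ st T i (S w) ≈ alpha T i ⊛ S (i ∷ w))
               × (n < m → S w ≈ st T i (S w))

record IsDoubleSchubertA (S : List ℕ → Series) : Set where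
  field
    inPoly   : ∀ u → InPoly (S u)
    wellDef  : ∀ u u' → EquivA u u' → S u ≈ S u'
    unit     : S [] ≈ oneS
    constTm  : ∀ u → ¬ EquivA u [] → S u [] [] [] ≡ 0ℤ
    partial  : ∀ u i m n → IsLenA u n → IsLenA (u ++ [ i ]) m →
                 (m < n → S u ⊖ swapZ i (S u) ≈ (zv i ⊖ zv (suc i)) ⊛ S (u ++ [ i ]))
               × (n < m → S u ≈ swapZ i (S u))
    delta    : ∀ u i m n → IsLenA u n → IsLenA (i ∷ u) m →
                 (m < n → S u ⊖ swapT i (S u) ≈ (tv (suc i) ⊖ tv i) ⊛ S (i ∷ u))
               × (n < m → S u ≈ swapT i (S u))

module Submission where

-- S_w(z,t;0) is compared with a candidate (S^A_u if w represents u ∈ S_∞,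
-- and 0 otherwise) by induction on ℓ(w).  Both are polynomials in finitely
-- many t, z, and a rigidity lemma (agree-at-zero) shows that two such
-- polynomials agree once they have the same constant term and the same
-- differences f - s f under all adjacent transpositions s of the t's and z's.
-- These differences are fixed by the descent recursion along s₁, s₂, …, which
-- applies since ℓ(s_i w) ≠ ℓ(w) (the parity of the length is a character of W,
-- equiv-parity) and since lengths in S_∞ agree with lengths in W
-- (IsLen⇒IsLenA).  Lengths exist only classically, so the induction runs in
-- the double-negation monad and ends with stability of equality in ℤ.

open import Defs
open import Level using (0ℓ)
open import Algebra.Bundles using (CommutativeRing)
import Algebra.Properties.CommutativeSemigroup as CommSemigroupProperties
open import Effect.Monad using (RawMonad)
open import Data.Bool using (Bool; true; false; if_then_else_; _∧_; not; _xor_)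
import Data.Bool.Properties as BoolP
open import Data.Nat as ℕ using (ℕ; zero; suc; _∸_; _≡ᵇ_; _<ᵇ_; _≤_; _<_; z≤n; s≤s; _⊔_)
import Data.Nat.Properties as ℕP
open import Data.Nat.Induction using (<-rec)
open import Data.Integer as ℤ using (ℤ; +_; -[1+_]; 0ℤ; 1ℤ; ∣_∣)
import Data.Integer.Properties as ℤP
open import Data.Integer.Tactic.RingSolver using (solve-∀)
open import Data.List using (List; []; _∷_; _++_; [_]; map; length)
import Data.List.Properties as ListP
open import Data.List.Relation.Unary.All as All using (All; []; _∷_)
import Data.List.Relation.Unary.All.Properties as AllP
open import Data.Product using (Σ; _×_; _,_; proj₁; proj₂)
open import Data.Sum using (_⊎_; inj₁; inj₂)
open import Data.Empty using (⊥-elim)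
open import Function.Base using (_∘_)
open import Function.Bundles using (mk⇔)
open import Relation.Binary.Definitions using (tri<; tri≈; tri>)
open import Relation.Binary.PropositionalEquality using (_≡_; _≢_; refl; sym; trans; cong; cong₂; subst; subst₂)
open import Relation.Nullary using (¬_; yes; no)
open import Relation.Nullary.Negation using (¬¬-Monad)
open import Relation.Nullary.Decidable using (¬¬-excluded-middle; decidable-stable; dec-true; dec-false; does-⇔)

open RawMonad (¬¬-Monad {a = 0ℓ}) using (pure; _>>=_)

-- Equality of integers is stable, so ¬¬-reasoning may end in a genuine equation.
stableℤ : {x y : ℤ} → ¬ ¬ (x ≡ y) → x ≡ y
stableℤ {x} {y} = decidable-stable (x ℤ.≟ y)

¬¬-least : (P : ℕ → Set) → ∀ n → P n → ¬ ¬ (Σ ℕ λ m → P m × (∀ k → P k → m ≤ k))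
¬¬-least P = <-rec (λ n → P n → ¬ ¬ Least) step
  where
  Least : Set
  Least = Σ ℕ λ m → P m × (∀ k → P k → m ≤ k)
  step : ∀ n → (∀ {m} → m < n → P m → ¬ ¬ Least) → P n → ¬ ¬ Least
  step n smaller pn = ¬¬-excluded-middle {A = Σ ℕ λ k → k < n × P k} >>= λ where
    (yes (k , k<n , pk)) → smaller k<n pk
    (no none-below)      → pure (n , pn , λ k pk → ℕP.≮⇒≥ (λ k<n → none-below (k , k<n , pk)))

allZero⇒get≡0 : ∀ l → allZero l ≡ true → ∀ p → get l p ≡ 0
allZero⇒get≡0 []          _ p       = refl
allZero⇒get≡0 (zero ∷ l)  h zero    = refl
allZero⇒get≡0 (zero ∷ l)  h (suc p) = allZero⇒get≡0 l h p
allZero⇒get≡0 (suc _ ∷ l) () p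

get≡0⇒allZero : ∀ l → (∀ p → get l p ≡ 0) → allZero l ≡ true
get≡0⇒allZero []          h = refl
get≡0⇒allZero (zero ∷ l)  h = get≡0⇒allZero l (λ p → h (suc p))
get≡0⇒allZero (suc _ ∷ l) h with h 0
... | ()

get≢0⇒¬allZero : ∀ l p → get l p ≢ 0 → allZero l ≡ false
get≢0⇒¬allZero l p ne with allZero l in eq
... | false = refl
... | true  = ⊥-elim (ne (allZero⇒get≡0 l eq p))

¬allZero⇒get≢0 : ∀ l → allZero l ≡ false → Σ ℕ λ p → get l p ≢ 0
¬allZero⇒get≢0 []          ()
¬allZero⇒get≢0 (zero ∷ l)  h with ¬allZero⇒get≢0 l h
... | p , ne = suc p , ne
¬allZero⇒get≢0 (suc _ ∷ l) h = 0 , λ ()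

allZero⇒sum≡0 : ∀ l → allZero l ≡ true → sumL l ≡ 0
allZero⇒sum≡0 []          h = refl
allZero⇒sum≡0 (zero ∷ l)  h = allZero⇒sum≡0 l h
allZero⇒sum≡0 (suc _ ∷ l) ()

splits-allZero : ∀ l → allZero l ≡ true → splits l ≡ (l , l) ∷ []
splits-allZero []          h = refl
splits-allZero (zero ∷ l)  h rewrite splits-allZero l h = refl
splits-allZero (suc _ ∷ l) ()

IsSplitting : List ℕ → List ℕ × List ℕ → Set
IsSplitting l (l₁ , l₂) = ∀ p → get l p ≡ get l₁ p ℕ.+ get l₂ p

splits-sound : ∀ l → All (IsSplitting l) (splits l)
splits-sound []      = (λ p → refl) ∷ []
splits-sound (e ∷ l) = AllP.concat⁺ (AllP.map⁺ (All.map prefix (AllP.all-upTo (suc e))))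
  where
  prefix : ∀ {j} → j < suc e →
           All (IsSplitting (e ∷ l)) (map (λ pq → (j ∷ proj₁ pq , (e ∸ j) ∷ proj₂ pq)) (splits l))
  prefix {j} (s≤s j≤e) = AllP.map⁺ (All.map (λ ok → λ where
      zero    → sym (ℕP.m+[n∸m]≡n j≤e)
      (suc p) → ok p) (splits-sound l))

sumℤ-zeros : ∀ {l} → All (_≡ 0ℤ) l → sumℤ l ≡ 0ℤ
sumℤ-zeros []         = refl
sumℤ-zeros (refl ∷ h) rewrite sumℤ-zeros h = refl

⊛-vanishes : ∀ (f g : Series) a b c →
  (∀ a₁ a₂ b₁ b₂ c₁ c₂ → IsSplitting a (a₁ , a₂) → IsSplitting b (b₁ , b₂) → IsSplitting c (c₁ , c₂) →
     f a₁ b₁ c₁ ℤ.* g a₂ b₂ c₂ ≡ 0ℤ) →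
  (f ⊛ g) a b c ≡ 0ℤ
⊛-vanishes f g a b c h =
  sumℤ-zeros (AllP.concat⁺ (AllP.map⁺ (All.map (λ {sa} oa →
    AllP.concat⁺ (AllP.map⁺ (All.map (λ {sb} ob →
      AllP.map⁺ (All.map (λ {sc} oc → h _ _ _ _ _ _ oa ob oc) (splits-sound c))) (splits-sound b))))
    (splits-sound a))))

infix 4 _≈₀_
_≈₀_ : Series → Series → Set
f ≈₀ g = ∀ a b → f a b [] ≡ g a b []

⊛-cong₀ : ∀ {f f' g g'} → f ≈₀ f' → g ≈₀ g' → f ⊛ g ≈₀ f' ⊛ g'
⊛-cong₀ hf hg a b =
  cong sumℤ (ListP.concatMap-cong (λ sa → ListP.concatMap-cong (λ sb →
    cong (_∷ []) (cong₂ ℤ._*_ (hf (proj₁ sa) (proj₁ sb)) (hg (proj₂ sa) (proj₂ sb)))) (splits b)) (splits a))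

guard-fails : ∀ x y z {n : ℤ} → (x ≡ false ⊎ y ≡ false ⊎ z ≡ false) → (if x ∧ y ∧ z then n else 0ℤ) ≡ 0ℤ
guard-fails false _     _     _                = refl
guard-fails true  false _     _                = refl
guard-fails true  true  false _                = refl
guard-fails true  true  true  (inj₁ ())
guard-fails true  true  true  (inj₂ (inj₁ ()))
guard-fails true  true  true  (inj₂ (inj₂ ()))

isUnit⇒get≡0 : ∀ k l → isUnit k l ≡ true → ∀ p → k < p → get l p ≡ 0
isUnit⇒get≡0 zero    (suc zero ∷ l)    h (suc p) _         = allZero⇒get≡0 l h p
isUnit⇒get≡0 (suc k) (zero ∷ l)        h (suc p) (s≤s k<p) = isUnit⇒get≡0 k l h p k<p
isUnit⇒get≡0 zero    []                () _ _
isUnit⇒get≡0 zero    (zero ∷ l)        () _ _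
isUnit⇒get≡0 zero    (suc (suc _) ∷ l) () _ _
isUnit⇒get≡0 (suc k) []                () _ _
isUnit⇒get≡0 (suc k) (suc _ ∷ l)       () _ _

isUnit-beyond : ∀ k l p → k < p → get l p ≢ 0 → isUnit k l ≡ false
isUnit-beyond k l p k<p ne with isUnit k l in eq
... | false = refl
... | true  = ⊥-elim (ne (isUnit⇒get≡0 k l eq p k<p))

isUnit-sum : ∀ k l → isUnit k l ≡ true → sumL l ≡ 1
isUnit-sum zero    (suc zero ∷ l)    h = cong suc (allZero⇒sum≡0 l h)
isUnit-sum (suc k) (zero ∷ l)        h = isUnit-sum k l h
isUnit-sum zero    []                ()
isUnit-sum zero    (zero ∷ l)        ()
isUnit-sum zero    (suc (suc _) ∷ l) ()
isUnit-sum (suc k) []                ()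
isUnit-sum (suc k) (suc _ ∷ l)       ()

isUnit-allZero : ∀ k l → allZero l ≡ true → isUnit k l ≡ false
isUnit-allZero k l h with isUnit k l in eq
... | false = refl
... | true with () ← trans (sym (allZero⇒sum≡0 l h)) (isUnit-sum k l eq)

-- Bounded N f: f involves none of the variables t_p, z_p with p ≥ N (as
-- exponent positions, i.e. indices p + 1).
Bounded : ℕ → Series → Set
Bounded N f = ∀ a b c p → N ≤ p → (get a p ≢ 0 ⊎ get b p ≢ 0) → f a b c ≡ 0ℤ

bounded-xOnly : ∀ (G : List ℕ → Bool) (v : List ℕ → ℤ) →
  Bounded 0 (λ a b c → if allZero a ∧ allZero b ∧ G c then v c else 0ℤ)
bounded-xOnly G v a b c p _ (inj₁ ne) = guard-fails (allZero a) (allZero b) (G c) (inj₁ (get≢0⇒¬allZero a p ne))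
bounded-xOnly G v a b c p _ (inj₂ ne) = guard-fails (allZero a) (allZero b) (G c) (inj₂ (inj₁ (get≢0⇒¬allZero b p ne)))

bounded-gamGen : ∀ T k → Bounded 0 (gamGen T k)
bounded-gamGen B k = bounded-xOnly (λ c → sumL c ℕ.≡ᵇ k) (λ c → ℤ.+ (2 ℕ.^ (nz c ∸ 1)))
bounded-gamGen C k = bounded-xOnly (λ c → sumL c ℕ.≡ᵇ k) (λ c → ℤ.+ (2 ℕ.^ nz c))
bounded-gamGen D k = bounded-xOnly (λ c → sumL c ℕ.≡ᵇ k) (λ c → ℤ.+ (2 ℕ.^ (nz c ∸ 1)))

bounded-tv : ∀ k → Bounded (suc k) (tv k)
bounded-tv k a b c p k<p (inj₁ ne) = guard-fails (isUnit k a) (allZero b) (allZero c) (inj₁ (isUnit-beyond k a p k<p ne))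
bounded-tv k a b c p k<p (inj₂ ne) = guard-fails (isUnit k a) (allZero b) (allZero c) (inj₂ (inj₁ (get≢0⇒¬allZero b p ne)))

bounded-zv : ∀ k → Bounded (suc k) (zv k)
bounded-zv k a b c p k<p (inj₁ ne) = guard-fails (allZero a) (isUnit k b) (allZero c) (inj₁ (get≢0⇒¬allZero a p ne))
bounded-zv k a b c p k<p (inj₂ ne) = guard-fails (allZero a) (isUnit k b) (allZero c) (inj₂ (inj₁ (isUnit-beyond k b p k<p ne)))

bounded-⊕ : ∀ {f g N M} → Bounded N f → Bounded M g → Bounded (N ⊔ M) (f ⊕ g)
bounded-⊕ {N = N} {M} hf hg a b c p le occurs
  rewrite hf a b c p (ℕP.≤-trans (ℕP.m≤m⊔n N M) le) occurs
        | hg a b c p (ℕP.≤-trans (ℕP.m≤n⊔m N M) le) occurs = refl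

+≢0 : ∀ {x y} → x ℕ.+ y ≢ 0 → x ≢ 0 ⊎ y ≢ 0
+≢0 {zero}  {zero}  h = ⊥-elim (h refl)
+≢0 {zero}  {suc _} h = inj₂ (λ ())
+≢0 {suc _}         h = inj₁ (λ ())

bounded-⊛ : ∀ {f g N M} → Bounded N f → Bounded M g → Bounded (N ⊔ M) (f ⊛ g)
bounded-⊛ {f} {g} {N} {M} hf hg a b c p le occurs = ⊛-vanishes f g a b c (term occurs)
  where
  le₁ = ℕP.≤-trans (ℕP.m≤m⊔n N M) le
  le₂ = ℕP.≤-trans (ℕP.m≤n⊔m N M) le
  term : (get a p ≢ 0 ⊎ get b p ≢ 0) →
         ∀ a₁ a₂ b₁ b₂ c₁ c₂ → IsSplitting a (a₁ , a₂) → IsSplitting b (b₁ , b₂) → IsSplitting c (c₁ , c₂) →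
         f a₁ b₁ c₁ ℤ.* g a₂ b₂ c₂ ≡ 0ℤ
  term (inj₁ ne) a₁ a₂ b₁ b₂ c₁ c₂ oa ob _ with +≢0 (λ e → ne (trans (oa p) e))
  ... | inj₁ ne₁ rewrite hf a₁ b₁ c₁ p le₁ (inj₁ ne₁) = refl
  ... | inj₂ ne₂ rewrite hg a₂ b₂ c₂ p le₂ (inj₁ ne₂) = ℤP.*-zeroʳ (f a₁ b₁ c₁)
  term (inj₂ ne) a₁ a₂ b₁ b₂ c₁ c₂ oa ob _ with +≢0 (λ e → ne (trans (ob p) e))
  ... | inj₁ ne₁ rewrite hf a₁ b₁ c₁ p le₁ (inj₂ ne₁) = refl
  ... | inj₂ ne₂ rewrite hg a₂ b₂ c₂ p le₂ (inj₂ ne₂) = ℤP.*-zeroʳ (f a₁ b₁ c₁)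

bounded-R : ∀ {T f} → InR T f → Σ ℕ λ N → Bounded N f
bounded-R (cst n)   = 0 , bounded-xOnly allZero (λ _ → n)
bounded-R (tV k)    = suc k , bounded-tv k
bounded-R (zV k)    = suc k , bounded-zv k
bounded-R {T} (gV k) = 0 , bounded-gamGen T (suc k)
bounded-R (add x y) = _ , bounded-⊕ (proj₂ (bounded-R x)) (proj₂ (bounded-R y))
bounded-R (mul x y) = _ , bounded-⊛ (proj₂ (bounded-R x)) (proj₂ (bounded-R y))
bounded-R (ext e x) = _ , λ a b c p le occurs → trans (e a b c) (proj₂ (bounded-R x) a b c p le occurs)

ConstantStable : Series → Set
ConstantStable f = ∀ a b c → allZero a ≡ true → allZero b ≡ true → allZero c ≡ true → f a b c ≡ f [] [] []

constantStable-R : ∀ {T f} → InR T f → ConstantStable f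
constantStable-R (cst n) a b c ha hb hc rewrite ha | hb | hc = refl
constantStable-R (tV k) a b c ha hb hc rewrite isUnit-allZero k a ha | isUnit-allZero k [] refl = refl
constantStable-R (zV k) a b c ha hb hc rewrite ha | isUnit-allZero k b hb | isUnit-allZero k [] refl = refl
constantStable-R {B} (gV k) a b c ha hb hc rewrite ha | hb | allZero⇒sum≡0 c hc = refl
constantStable-R {C} (gV k) a b c ha hb hc rewrite ha | hb | allZero⇒sum≡0 c hc = refl
constantStable-R {D} (gV k) a b c ha hb hc rewrite ha | hb | allZero⇒sum≡0 c hc = refl
constantStable-R (add x y) a b c ha hb hc =
  cong₂ ℤ._+_ (constantStable-R x a b c ha hb hc) (constantStable-R y a b c ha hb hc)
constantStable-R (mul x y) a b c ha hb hc
  rewrite splits-allZero a ha | splits-allZero b hb | splits-allZero c hc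
        | constantStable-R x a b c ha hb hc | constantStable-R y a b c ha hb hc = refl
constantStable-R (ext e x) a b c ha hb hc =
  trans (e a b c) (trans (constantStable-R x a b c ha hb hc) (sym (e [] [] [])))

poly⇒R : ∀ {T f} → InPoly f → InR T f
poly⇒R (cst n)   = cst n
poly⇒R (tV k)    = tV k
poly⇒R (zV k)    = zV k
poly⇒R (add x y) = add (poly⇒R x) (poly⇒R y)
poly⇒R (mul x y) = mul (poly⇒R x) (poly⇒R y)
poly⇒R (ext e x) = ext e (poly⇒R x)

poly-x-free : ∀ {f} → InPoly f → ∀ a b c → allZero c ≡ false → f a b c ≡ 0ℤ
poly-x-free (cst n)   a b c hc = guard-fails (allZero a) (allZero b) (allZero c) (inj₂ (inj₂ hc))
poly-x-free (tV k)    a b c hc = guard-fails (isUnit k a) (allZero b) (allZero c) (inj₂ (inj₂ hc))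
poly-x-free (zV k)    a b c hc = guard-fails (allZero a) (isUnit k b) (allZero c) (inj₂ (inj₂ hc))
poly-x-free (add x y) a b c hc rewrite poly-x-free x a b c hc | poly-x-free y a b c hc = refl
poly-x-free (mul {g} {h} x y) a b c hc = ⊛-vanishes g h a b c term
  where
  term : ∀ a₁ a₂ b₁ b₂ c₁ c₂ → IsSplitting a (a₁ , a₂) → IsSplitting b (b₁ , b₂) → IsSplitting c (c₁ , c₂) →
         g a₁ b₁ c₁ ℤ.* h a₂ b₂ c₂ ≡ 0ℤ
  term a₁ a₂ b₁ b₂ c₁ c₂ _ _ oc with allZero c₁ in e₁ | allZero c₂ in e₂
  ... | false | _     rewrite poly-x-free x a₁ b₁ c₁ e₁ = refl
  ... | true  | false rewrite poly-x-free y a₂ b₂ c₂ e₂ = ℤP.*-zeroʳ (g a₁ b₁ c₁)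
  ... | true  | true  with () ← trans (sym hc)
         (get≡0⇒allZero c (λ p → trans (oc p) (cong₂ ℕ._+_ (allZero⇒get≡0 c₁ e₁ p) (allZero⇒get≡0 c₂ e₂ p))))
poly-x-free (ext e x) a b c hc = trans (e a b c) (poly-x-free x a b c hc)

poly-x-padding : ∀ {f} → InPoly f → ∀ a b c → allZero c ≡ true → f a b c ≡ f a b []
poly-x-padding (cst n)   a b c hc rewrite hc = refl
poly-x-padding (tV k)    a b c hc rewrite hc = refl
poly-x-padding (zV k)    a b c hc rewrite hc = refl
poly-x-padding (add x y) a b c hc = cong₂ ℤ._+_ (poly-x-padding x a b c hc) (poly-x-padding y a b c hc)
poly-x-padding (mul {g} {h} x y) a b c hc rewrite splits-allZero c hc =
  ⊛-cong₀ {f = λ a' b' _ → g a' b' c} {f' = g} {g = λ a' b' _ → h a' b' c} {g' = h}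
    (λ a' b' → poly-x-padding x a' b' c hc) (λ a' b' → poly-x-padding y a' b' c hc) a b
poly-x-padding (ext e x) a b c hc = trans (e a b c) (trans (poly-x-padding x a b c hc) (sym (e a b [])))

spec-poly : ∀ {f} → InPoly f → spec f ≈ f
spec-poly p a b c with allZero c in hc
... | true  = sym (poly-x-padding p a b c hc)
... | false = sym (poly-x-free p a b c hc)

spec-cong₀ : ∀ {f g} → f ≈₀ g → spec f ≈ spec g
spec-cong₀ h a b c = cong (λ v → if allZero c then v else 0ℤ) (h a b)

-- Rigidity: symmetric bounded functions are determined by their constant term.

get-set : ∀ l q v → get (set l q v) q ≡ v
get-set []      zero    v = refl
get-set []      (suc q) v = get-set [] q v
get-set (e ∷ l) zero    v = refl
get-set (e ∷ l) (suc q) v = get-set l q v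

get-swapL : ∀ l p → get (swapL l p (suc p)) (suc p) ≡ get l p
get-swapL l p = get-set (set l p (get l (suc p))) (suc p) (get l p)

-- A function F of an exponent list which is (¬¬-)invariant under adjacent
-- transpositions and vanishes as soon as an index ≥ N occurs vanishes on
-- every nonzero exponent list: transpositions move a nonzero exponent past N.
symmetric-bounded-vanishes : (F : List ℕ → ℤ) (N : ℕ) →
  (∀ k a → ¬ ¬ (F a ≡ F (swapL a k (suc k)))) →
  (∀ a p → N ≤ p → get a p ≢ 0 → F a ≡ 0ℤ) →
  ∀ a → allZero a ≡ false → ¬ ¬ (F a ≡ 0ℤ)
symmetric-bounded-vanishes F N symmetric bounded a nonzero with ¬allZero⇒get≢0 a nonzero
... | p , ne = do
  (a' , Fa≡Fa' , ne') ← shift N a ne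
  pure (trans Fa≡Fa' (bounded a' (N ℕ.+ p) (ℕP.m≤m+n N p) ne'))
  where
  shift : ∀ d a → get a p ≢ 0 → ¬ ¬ (Σ (List ℕ) λ a' → F a ≡ F a' × get a' (d ℕ.+ p) ≢ 0)
  shift zero    a ne = pure (a , refl , ne)
  shift (suc d) a ne = do
    (a' , Fa≡Fa' , ne') ← shift d a ne
    Fa'≡Fa'' ← symmetric (d ℕ.+ p) a'
    pure (swapL a' (d ℕ.+ p) (suc (d ℕ.+ p)) , trans Fa≡Fa' Fa'≡Fa'' ,
          λ e → ne' (trans (sym (get-swapL a' (d ℕ.+ p))) e))

differences-swap : ∀ {x x' y y'} → x ℤ.- x' ≡ y ℤ.- y' → x ℤ.- y ≡ x' ℤ.- y'
differences-swap {x} {x'} {y} {y'} h =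
  ℤP.i-j≡0⇒i≡j _ _ (trans (rearrange x x' y y') (ℤP.i≡j⇒i-j≡0 h))
  where
  rearrange : ∀ x x' y y' → (x ℤ.- y) ℤ.- (x' ℤ.- y') ≡ (x ℤ.- x') ℤ.- (y ℤ.- y')
  rearrange = solve-∀

agree-at-zero : ∀ {f g N M} → Bounded N f → Bounded M g → ConstantStable f → ConstantStable g →
  f [] [] [] ≡ g [] [] [] →
  (∀ k a b → ¬ ¬ ((f ⊖ swapT k f) a b [] ≡ (g ⊖ swapT k g) a b [])) →
  (∀ k a b → ¬ ¬ ((f ⊖ swapZ k f) a b [] ≡ (g ⊖ swapZ k g) a b [])) →
  f ≈₀ g
agree-at-zero {f} {g} {N} {M} bf bg sf sg same-constant same-δ same-∂ a b =
  ℤP.i-j≡0⇒i≡j _ _ (stableℤ difference-vanishes)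
  where
  Δ : List ℕ → List ℕ → ℤ
  Δ a b = f a b [] ℤ.- g a b []
  Δ-invariant : ∀ {a a' b b'} → ¬ ¬ (f a b [] ℤ.- f a' b' [] ≡ g a b [] ℤ.- g a' b' []) → ¬ ¬ (Δ a b ≡ Δ a' b')
  Δ-invariant {a} {a'} {b} {b'} same = do
    e ← same
    pure (differences-swap {f a b []} {f a' b' []} {g a b []} {g a' b' []} e)
  Δ-bounded : ∀ a b p → N ⊔ M ≤ p → (get a p ≢ 0 ⊎ get b p ≢ 0) → Δ a b ≡ 0ℤ
  Δ-bounded a b p le occurs
    rewrite bf a b [] p (ℕP.≤-trans (ℕP.m≤m⊔n N M) le) occurs
          | bg a b [] p (ℕP.≤-trans (ℕP.m≤n⊔m N M) le) occurs = refl
  difference-vanishes : ¬ ¬ (Δ a b ≡ 0ℤ)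
  difference-vanishes with allZero a in ha
  ... | false = symmetric-bounded-vanishes (λ a → Δ a b) (N ⊔ M)
                  (λ k a → Δ-invariant (same-δ k a b))
                  (λ a p le ne → Δ-bounded a b p le (inj₁ ne)) a ha
  ... | true with allZero b in hb
  ... | false = symmetric-bounded-vanishes (λ b → Δ a b) (N ⊔ M)
                  (λ k b → Δ-invariant (same-∂ k a b))
                  (λ b p le ne → Δ-bounded a b p le (inj₂ ne)) b hb
  ... | true = pure (trans (cong₂ ℤ._-_ (sf a b [] ha hb refl) (sg a b [] ha hb refl))
                           (ℤP.i≡j⇒i-j≡0 same-constant))

≡ᵇ-true : ∀ {m n} → m ≡ n → (m ≡ᵇ n) ≡ true
≡ᵇ-true {m} {n} = dec-true (m ℕ.≟ n)

≡ᵇ-false : ∀ {m n} → m ≢ n → (m ≡ᵇ n) ≡ false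
≡ᵇ-false {m} {n} = dec-false (m ℕ.≟ n)

n≡ᵇn : ∀ n → (n ≡ᵇ n) ≡ true
n≡ᵇn n = ≡ᵇ-true {n} refl

n≡ᵇ1+n : ∀ n → (n ≡ᵇ suc n) ≡ false
n≡ᵇ1+n n = ≡ᵇ-false (ℕP.1+n≢n {n} ∘ sym)

1+n≡ᵇn : ∀ n → (suc n ≡ᵇ n) ≡ false
1+n≡ᵇn n = ≡ᵇ-false (ℕP.1+n≢n {n})

<ᵇ-true : ∀ {m n} → m < n → (m <ᵇ n) ≡ true
<ᵇ-true {m} {n} = dec-true (m ℕ.<? n)

<ᵇ-false : ∀ {m n} → ¬ m < n → (m <ᵇ n) ≡ false
<ᵇ-false {m} {n} = dec-false (m ℕ.<? n)

data SwNCase (m n : ℕ) : Set where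
  lower : n ≡ m → SwNCase m n
  upper : n ≡ suc m → SwNCase m n
  fixed : n ≢ m → n ≢ suc m → SwNCase m n

swN-case : ∀ m n → SwNCase m n
swN-case m n with n ℕ.≟ m | n ℕ.≟ suc m
... | yes e | _     = lower e
... | no _  | yes e = upper e
... | no ne | no ne' = fixed ne ne'

swN-lower : ∀ m → swN m m ≡ suc m
swN-lower m rewrite n≡ᵇn m = refl

swN-upper : ∀ m → swN m (suc m) ≡ m
swN-upper m rewrite 1+n≡ᵇn m | n≡ᵇn m = refl

swN-fixed : ∀ m n → n ≢ m → n ≢ suc m → swN m n ≡ n
swN-fixed m n ne ne' rewrite ≡ᵇ-false ne | ≡ᵇ-false ne' = refl

swN-involutive : ∀ m n → swN m (swN m n) ≡ n
swN-involutive m n with swN-case m n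
... | lower refl rewrite swN-lower m = swN-upper m
... | upper refl rewrite swN-upper m = swN-lower m
... | fixed ne ne' rewrite swN-fixed m n ne ne' = swN-fixed m n ne ne'

-- For m ≥ 1 the transposition fixes 0, so it maps positive numbers to positive numbers.
swN-positive : ∀ m n → Σ ℕ λ j → swN (suc m) (suc n) ≡ suc j
swN-positive m n with swN-case (suc m) (suc n)
... | lower e      = suc m , trans (cong (swN (suc m)) e) (swN-lower (suc m))
... | upper e      = m , trans (cong (swN (suc m)) e) (swN-upper (suc m))
... | fixed ne ne' = n , swN-fixed (suc m) (suc n) ne ne'

swN-test : ∀ m a j → (swN m a ≡ᵇ j) ≡ (a ≡ᵇ swN m j)
swN-test m a j = does-⇔ (mk⇔ (λ e → trans (sym (swN-involutive m a)) (cong (swN m) e))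
                            (λ e → trans (cong (swN m) e) (swN-involutive m j)))
                        (swN m a ℕ.≟ j) (a ℕ.≟ swN m j)

-- reversed-by m a b: {a, b} = {m, m + 1}, the only pair whose order swN m reverses.
reversed-by : ℕ → ℕ → ℕ → Bool
reversed-by m a b = ((a ≡ᵇ m) ∧ (b ≡ᵇ suc m)) xor ((a ≡ᵇ suc m) ∧ (b ≡ᵇ m))

<ᵇ-skip-left : ∀ m a → a ≢ suc m → (suc m <ᵇ a) ≡ (m <ᵇ a)
<ᵇ-skip-left zero    zero          _  = refl
<ᵇ-skip-left zero    (suc zero)    ne = ⊥-elim (ne refl)
<ᵇ-skip-left zero    (suc (suc a)) _  = refl
<ᵇ-skip-left (suc m) zero          _  = refl
<ᵇ-skip-left (suc m) (suc a)       ne = <ᵇ-skip-left m a (λ e → ne (cong suc e))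

<ᵇ-skip-right : ∀ m a → a ≢ m → (a <ᵇ suc m) ≡ (a <ᵇ m)
<ᵇ-skip-right zero    zero    ne = ⊥-elim (ne refl)
<ᵇ-skip-right (suc m) zero    _  = refl
<ᵇ-skip-right zero    (suc a) _  = refl
<ᵇ-skip-right (suc m) (suc a) ne = <ᵇ-skip-right m a (λ e → ne (cong suc e))

swN-order : ∀ m a b → (swN m b <ᵇ swN m a) ≡ (b <ᵇ a) xor reversed-by m a b
swN-order m a b with swN-case m a | swN-case m b
... | lower refl | lower refl
  rewrite swN-lower m | <ᵇ-false (ℕP.<-irrefl {suc m} refl) | n≡ᵇn m | n≡ᵇ1+n m = refl
... | lower refl | upper refl
  rewrite swN-lower m | swN-upper m | <ᵇ-true (ℕP.n<1+n m) | <ᵇ-false (ℕP.<-asym (ℕP.n<1+n m)) | n≡ᵇn m | n≡ᵇ1+n m = refl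
... | upper refl | lower refl
  rewrite swN-lower m | swN-upper m | <ᵇ-true (ℕP.n<1+n m) | <ᵇ-false (ℕP.<-asym (ℕP.n<1+n m)) | n≡ᵇn m | 1+n≡ᵇn m = refl
... | upper refl | upper refl
  rewrite swN-upper m | <ᵇ-false (ℕP.<-irrefl {m} refl) | n≡ᵇn m | 1+n≡ᵇn m = refl
... | lower refl | fixed ne ne'
  rewrite swN-lower m | swN-fixed m b ne ne' | n≡ᵇn m | n≡ᵇ1+n m | ≡ᵇ-false ne'
  = trans (<ᵇ-skip-right m b ne) (sym (BoolP.xor-identityʳ _))
... | upper refl | fixed ne ne'
  rewrite swN-upper m | swN-fixed m b ne ne' | n≡ᵇn m | 1+n≡ᵇn m | ≡ᵇ-false ne
  = trans (sym (<ᵇ-skip-right m b ne)) (sym (BoolP.xor-identityʳ _))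
... | fixed ne ne' | lower refl
  rewrite swN-lower m | swN-fixed m a ne ne' | ≡ᵇ-false ne | ≡ᵇ-false ne'
  = trans (<ᵇ-skip-left m a ne') (sym (BoolP.xor-identityʳ _))
... | fixed ne ne' | upper refl
  rewrite swN-upper m | swN-fixed m a ne ne' | ≡ᵇ-false ne | ≡ᵇ-false ne'
  = trans (sym (<ᵇ-skip-left m a ne')) (sym (BoolP.xor-identityʳ _))
... | fixed ne ne' | fixed ne₂ ne₂'
  rewrite swN-fixed m a ne ne' | swN-fixed m b ne₂ ne₂' | ≡ᵇ-false ne | ≡ᵇ-false ne'
  = sym (BoolP.xor-identityʳ _)

isNeg : ℤ → Bool
isNeg (+ _)    = false
isNeg -[1+ _ ] = true

-- A description of how g : ℤ → ℤ moves signed values: absolute values are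
-- permuted by the involution σ, the sign of a value of absolute value n is
-- flipped iff flips n, and reverses a b says that σ reverses the order of a, b.
record SignedAction (g : ℤ → ℤ) : Set where
  field
    σ         : ℕ → ℕ
    flips     : ℕ → Bool
    reverses  : ℕ → ℕ → Bool
    abs-act   : ∀ x → ∣ g x ∣ ≡ σ ∣ x ∣
    sign-act  : ∀ x → isNeg (g x) ≡ isNeg x xor flips ∣ x ∣
    order-act : ∀ a b → (σ b <ᵇ σ a) ≡ (b <ᵇ a) xor reverses a b
    σ-test    : ∀ a j → (σ a ≡ᵇ j) ≡ (a ≡ᵇ σ j)

transpositionAction : ∀ m → SignedAction (mapAbs (swN (suc m)))
transpositionAction m = record
  { σ         = swN (suc m)
  ; flips     = λ _ → false
  ; reverses  = reversed-by (suc m)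
  ; abs-act   = abs-act
  ; sign-act  = λ x → trans (sign-act x) (sym (BoolP.xor-identityʳ _))
  ; order-act = swN-order (suc m)
  ; σ-test    = swN-test (suc m)
  }
  where
  abs-act : ∀ x → ∣ mapAbs (swN (suc m)) x ∣ ≡ swN (suc m) ∣ x ∣
  abs-act (+ n)    = refl
  abs-act -[1+ n ] = ℤP.∣-i∣≡∣i∣ (+ swN (suc m) (suc n))
  sign-act : ∀ x → isNeg (mapAbs (swN (suc m)) x) ≡ isNeg x
  sign-act (+ n)    = refl
  sign-act -[1+ n ] with swN-positive m n
  ... | j , e rewrite e = refl

negateOneAction : SignedAction (genAct B zero)
negateOneAction = record
  { σ         = λ n → n
  ; flips     = _≡ᵇ 1
  ; reverses  = λ _ _ → false
  ; abs-act   = abs-act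
  ; sign-act  = sign-act
  ; order-act = λ a b → sym (BoolP.xor-identityʳ _)
  ; σ-test    = λ a j → refl
  }
  where
  abs-act : ∀ x → ∣ genAct B zero x ∣ ≡ ∣ x ∣
  abs-act (+ zero)          = refl
  abs-act (+ suc zero)      = refl
  abs-act (+ suc (suc n))   = refl
  abs-act -[1+ zero ]       = refl
  abs-act -[1+ suc n ]      = refl
  sign-act : ∀ x → isNeg (genAct B zero x) ≡ isNeg x xor (∣ x ∣ ≡ᵇ 1)
  sign-act (+ zero)         = refl
  sign-act (+ suc zero)     = refl
  sign-act (+ suc (suc n))  = refl
  sign-act -[1+ zero ]      = refl
  sign-act -[1+ suc n ]     = refl

negateSwapAction : SignedAction (genAct D zero)
negateSwapAction = record
  { σ         = swN 1
  ; flips     = λ n → (n ≡ᵇ 1) xor (n ≡ᵇ 2)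
  ; reverses  = reversed-by 1
  ; abs-act   = abs-act
  ; sign-act  = sign-act
  ; order-act = swN-order 1
  ; σ-test    = swN-test 1
  }
  where
  abs-act : ∀ x → ∣ genAct D zero x ∣ ≡ swN 1 ∣ x ∣
  abs-act (+ zero)                = refl
  abs-act (+ suc zero)            = refl
  abs-act (+ suc (suc zero))      = refl
  abs-act (+ suc (suc (suc n)))   = refl
  abs-act -[1+ zero ]             = refl
  abs-act -[1+ suc zero ]         = refl
  abs-act -[1+ suc (suc n) ]      = refl
  sign-act : ∀ x → isNeg (genAct D zero x) ≡ isNeg x xor ((∣ x ∣ ≡ᵇ 1) xor (∣ x ∣ ≡ᵇ 2))
  sign-act (+ zero)               = refl
  sign-act (+ suc zero)           = refl
  sign-act (+ suc (suc zero))     = refl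
  sign-act (+ suc (suc (suc n)))  = refl
  sign-act -[1+ zero ]            = refl
  sign-act -[1+ suc zero ]        = refl
  sign-act -[1+ suc (suc n) ]     = refl

genAction : ∀ T i → SignedAction (genAct T i)
genAction B zero    = negateOneAction
genAction C zero    = negateOneAction
genAction D zero    = negateSwapAction
genAction B (suc k) = transpositionAction k
genAction C (suc k) = transpositionAction k
genAction D (suc k) = transpositionAction k

xor-interchange : ∀ p q x y → (p xor q) xor (x xor y) ≡ (p xor x) xor (q xor y)
xor-interchange = CommSemigroupProperties.interchange
  (CommutativeRing.+-commutativeSemigroup BoolP.xor-∧-commutativeRing)

count : (ℤ → Bool) → List ℤ → Bool
count P []      = false
count P (x ∷ L) = P x xor count P L

count-map : ∀ P g L → count P (map g L) ≡ count (P ∘ g) L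
count-map P g []      = refl
count-map P g (x ∷ L) = cong (P (g x) xor_) (count-map P g L)

count-cong : ∀ {P Q} → (∀ x → P x ≡ Q x) → ∀ L → count P L ≡ count Q L
count-cong h []      = refl
count-cong h (x ∷ L) = cong₂ _xor_ (h x) (count-cong h L)

count-false : ∀ L → count (λ _ → false) L ≡ false
count-false []      = refl
count-false (x ∷ L) = count-false L

count-xor : ∀ P Q L → count (λ x → P x xor Q x) L ≡ count P L xor count Q L
count-xor P Q []      = refl
count-xor P Q (x ∷ L) =
  trans (cong ((P x xor Q x) xor_) (count-xor P Q L)) (xor-interchange (P x) (Q x) (count P L) (count Q L))

count-∧ : ∀ α P L → count (λ y → α ∧ P y) L ≡ α ∧ count P L
count-∧ α P []      = sym (BoolP.∧-zeroʳ α)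
count-∧ α P (x ∷ L) = trans (cong ((α ∧ P x) xor_) (count-∧ α P L)) (sym (BoolP.∧-distribˡ-xor α (P x) (count P L)))

pairs : (ℕ → ℕ → Bool) → List ℤ → Bool
pairs p []      = false
pairs p (x ∷ L) = count (λ y → p ∣ x ∣ ∣ y ∣) L xor pairs p L

pairs-cong : ∀ {p q} → (∀ a b → p a b ≡ q a b) → ∀ L → pairs p L ≡ pairs q L
pairs-cong h []      = refl
pairs-cong h (x ∷ L) = cong₂ _xor_ (count-cong (λ y → h ∣ x ∣ ∣ y ∣) L) (pairs-cong h L)

pairs-xor : ∀ p q L → pairs (λ a b → p a b xor q a b) L ≡ pairs p L xor pairs q L
pairs-xor p q []      = refl
pairs-xor p q (x ∷ L) =
  trans (cong₂ _xor_ (count-xor (λ y → p ∣ x ∣ ∣ y ∣) (λ y → q ∣ x ∣ ∣ y ∣) L) (pairs-xor p q L))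
        (xor-interchange (count (λ y → p ∣ x ∣ ∣ y ∣) L) (count (λ y → q ∣ x ∣ ∣ y ∣) L) (pairs p L) (pairs q L))

-- Pairs are evaluated on absolute values, so g may be replaced by σ.
pairs-map : ∀ p (g : ℤ → ℤ) (σ : ℕ → ℕ) → (∀ x → ∣ g x ∣ ≡ σ ∣ x ∣) →
  ∀ L → pairs p (map g L) ≡ pairs (λ a b → p (σ a) (σ b)) L
pairs-map p g σ h []      = refl
pairs-map p g σ h (x ∷ L) =
  cong₂ _xor_ (trans (count-map _ g L) (count-cong (λ y → cong₂ p (h x) (h y)) L)) (pairs-map p g σ h L)

negatives : List ℤ → Bool
negatives = count isNeg

inversions : List ℤ → Bool
inversions = pairs (λ a b → b <ᵇ a)

multiplicity : ℕ → List ℤ → Bool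
multiplicity j = count (λ y → ∣ y ∣ ≡ᵇ j)

-- The sign character of a list of signed values; for the values of w on
-- {1, …, N} it will turn out to be the parity of ℓ(w).
sign : List ℤ → Bool
sign L = negatives L xor inversions L

module _ {g : ℤ → ℤ} (A : SignedAction g) where
  open SignedAction A

  sign-map : ∀ L → sign (map g L) ≡ sign L xor (count (λ x → flips ∣ x ∣) L xor pairs reverses L)
  sign-map L = trans (cong₂ _xor_ negatives-map inversions-map)
                     (xor-interchange (negatives L) _ (inversions L) _)
    where
    negatives-map : negatives (map g L) ≡ negatives L xor count (λ x → flips ∣ x ∣) L
    negatives-map = trans (count-map isNeg g L) (trans (count-cong sign-act L) (count-xor _ _ L))
    inversions-map : inversions (map g L) ≡ inversions L xor pairs reverses L
    inversions-map = trans (pairs-map _ g σ abs-act L) (trans (pairs-cong order-act L) (pairs-xor _ _ L))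

  multiplicity-map : ∀ j L → multiplicity j (map g L) ≡ multiplicity (σ j) L
  multiplicity-map j L =
    trans (count-map _ g L) (count-cong (λ y → trans (cong (_≡ᵇ j) (abs-act y)) (σ-test ∣ y ∣ j)) L)

pairs-none : ∀ L → pairs (λ _ _ → false) L ≡ false
pairs-none []      = refl
pairs-none (x ∷ L) rewrite count-false L = pairs-none L

not-both : ∀ a j → ((a ≡ᵇ j) ∧ (a ≡ᵇ suc j)) ≡ false
not-both a j with a ℕ.≟ j
... | yes refl rewrite n≡ᵇ1+n a = BoolP.∧-zeroʳ _
... | no ne    rewrite ≡ᵇ-false ne = refl

-- Distributing the pairs reversed by (j j+1) over an element of absolute
-- value j (resp. j + 1) and the rest of the list.
reversed-step : ∀ α β X Y → (α ∧ β) ≡ false → ((α ∧ Y) xor (β ∧ X)) xor (X ∧ Y) ≡ (α xor X) ∧ (β xor Y)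
reversed-step false false X     Y     _ = refl
reversed-step false true  false false _ = refl
reversed-step false true  false true  _ = refl
reversed-step false true  true  false _ = refl
reversed-step false true  true  true  _ = refl
reversed-step true  false false false _ = refl
reversed-step true  false false true  _ = refl
reversed-step true  false true  false _ = refl
reversed-step true  false true  true  _ = refl
reversed-step true  true  _     _     ()

pairs-reversed-by : ∀ j L → pairs (reversed-by j) L ≡ multiplicity j L ∧ multiplicity (suc j) L
pairs-reversed-by j []      = refl
pairs-reversed-by j (x ∷ L) =
  trans (cong₂ _xor_ head (pairs-reversed-by j L))
        (reversed-step (∣ x ∣ ≡ᵇ j) (∣ x ∣ ≡ᵇ suc j) (multiplicity j L) (multiplicity (suc j) L) (not-both ∣ x ∣ j))
  where
  head : count (λ y → reversed-by j ∣ x ∣ ∣ y ∣) L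
       ≡ ((∣ x ∣ ≡ᵇ j) ∧ multiplicity (suc j) L) xor ((∣ x ∣ ≡ᵇ suc j) ∧ multiplicity j L)
  head = trans (count-xor (λ y → (∣ x ∣ ≡ᵇ j) ∧ (∣ y ∣ ≡ᵇ suc j)) (λ y → (∣ x ∣ ≡ᵇ suc j) ∧ (∣ y ∣ ≡ᵇ j)) L)
               (cong₂ _xor_ (count-∧ (∣ x ∣ ≡ᵇ j) (λ y → ∣ y ∣ ≡ᵇ suc j) L)
                            (count-∧ (∣ x ∣ ≡ᵇ suc j) (λ y → ∣ y ∣ ≡ᵇ j) L))

range : ℕ → List ℤ
range zero    = []
range (suc N) = + suc N ∷ range N

multiplicity-beyond : ∀ N j → N < j → multiplicity j (range N) ≡ false
multiplicity-beyond zero    j _  = refl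
multiplicity-beyond (suc N) j lt rewrite ≡ᵇ-false (λ e → ℕP.<-irrefl e lt) =
  multiplicity-beyond N j (ℕP.<-trans (ℕP.n<1+n N) lt)

multiplicity-inside : ∀ N j → 1 ≤ j → j ≤ N → multiplicity j (range N) ≡ true
multiplicity-inside zero    (suc j) _   ()
multiplicity-inside (suc N) j 1≤j j≤N with suc N ℕ.≟ j
... | yes e  rewrite ≡ᵇ-true e | multiplicity-beyond N j (subst (N <_) e (ℕP.n<1+n N)) = refl
... | no ne  rewrite ≡ᵇ-false ne = multiplicity-inside N j 1≤j (ℕP.≤-pred (ℕP.≤∧≢⇒< j≤N (ne ∘ sym)))

swN-range : ∀ m N → 1 ≤ m → suc m ≤ N → ∀ j → multiplicity (swN m j) (range N) ≡ multiplicity j (range N)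
swN-range m N 1≤m m<N j with swN-case m j
... | lower refl rewrite swN-lower m =
  trans (multiplicity-inside N (suc m) (s≤s z≤n) m<N) (sym (multiplicity-inside N m 1≤m (ℕP.<⇒≤ m<N)))
... | upper refl rewrite swN-upper m =
  trans (multiplicity-inside N m 1≤m (ℕP.<⇒≤ m<N)) (sym (multiplicity-inside N (suc m) (s≤s z≤n) m<N))
... | fixed ne ne' rewrite swN-fixed m j ne ne' = refl

Balanced : ℕ → List ℤ → Set
Balanced N L = ∀ j → multiplicity j L ≡ multiplicity j (range N)

generator-range : ∀ T i N → suc (suc i) ≤ N →
  ∀ j → multiplicity (SignedAction.σ (genAction T i) j) (range N) ≡ multiplicity j (range N)
generator-range B zero    N le = λ j → refl
generator-range C zero    N le = λ j → refl
generator-range D zero    N le = swN-range 1 N (s≤s z≤n) le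
generator-range B (suc k) N le = swN-range (suc k) N (s≤s z≤n) (ℕP.<⇒≤ le)
generator-range C (suc k) N le = swN-range (suc k) N (s≤s z≤n) (ℕP.<⇒≤ le)
generator-range D (suc k) N le = swN-range (suc k) N (s≤s z≤n) (ℕP.<⇒≤ le)

present : ∀ N L → Balanced N L → ∀ j → {{_ : ℕ.NonZero j}} → j ≤ N → multiplicity j L ≡ true
present N L bal (suc j) le = trans (bal (suc j)) (multiplicity-inside N (suc j) (s≤s z≤n) le)

transposition-odd : ∀ k N L → suc (suc (suc k)) ≤ N → Balanced N L →
  count (λ _ → false) L xor pairs (reversed-by (suc k)) L ≡ true
transposition-odd k N L le bal
  rewrite count-false L | pairs-reversed-by (suc k) L
        | present N L bal (suc k) (ℕP.<⇒≤ (ℕP.<⇒≤ le)) | present N L bal (suc (suc k)) (ℕP.<⇒≤ le) = refl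

-- On a balanced list every generator changes an odd number of signs and
-- pairs: s₀ flips the sign of the ±1, s_{1̂} flips ±1, ±2 and reverses
-- their order, and s_{k+1} only reverses the pair k + 1, k + 2.
generator-odd : ∀ T i N L → suc (suc i) ≤ N → Balanced N L →
  let open SignedAction (genAction T i) in count (λ x → flips ∣ x ∣) L xor pairs reverses L ≡ true
generator-odd B zero    N L le bal rewrite pairs-none L | present N L bal 1 (ℕP.<⇒≤ le) = refl
generator-odd C zero    N L le bal rewrite pairs-none L | present N L bal 1 (ℕP.<⇒≤ le) = refl
generator-odd D zero    N L le bal
  rewrite count-xor (λ x → ∣ x ∣ ≡ᵇ 1) (λ x → ∣ x ∣ ≡ᵇ 2) L | pairs-reversed-by 1 L
        | present N L bal 1 (ℕP.<⇒≤ le) | present N L bal 2 le = refl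
generator-odd B (suc k) N L le bal = transposition-odd k N L le bal
generator-odd C (suc k) N L le bal = transposition-odd k N L le bal
generator-odd D (suc k) N L le bal = transposition-odd k N L le bal

generator-step : ∀ T i N L → suc (suc i) ≤ N → Balanced N L →
  Balanced N (map (genAct T i) L) × sign (map (genAct T i) L) ≡ not (sign L)
generator-step T i N L le bal =
  (λ j → trans (multiplicity-map A j L) (trans (bal (σ j)) (generator-range T i N le j))) ,
  trans (sign-map A L) (trans (cong (sign L xor_) (generator-odd T i N L le bal))
                              (trans (BoolP.xor-comm (sign L) true) (BoolP.true-xor (sign L))))
  where
  A = genAction T i
  open SignedAction A using (σ)

odd : ℕ → Bool
odd zero    = false
odd (suc n) = not (odd n)

-- All letters of w act inside {1, …, N} once support w ≤ N.
support : List ℕ → ℕ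
support []      = 0
support (i ∷ w) = suc (suc i) ⊔ support w

word-sign : ∀ T w N → support w ≤ N →
  Balanced N (map (actW T w) (range N)) × sign (map (actW T w) (range N)) ≡ odd (length w) xor sign (range N)
word-sign T []      N le rewrite ListP.map-id (range N) = (λ j → refl) , refl
word-sign T (i ∷ w) N le
  rewrite ListP.map-∘ {g = genAct T i} {f = actW T w} (range N)
  with word-sign T w N (ℕP.m⊔n≤o⇒n≤o (suc (suc i)) (support w) le)
... | bal , sign-w with generator-step T i N (map (actW T w) (range N)) (ℕP.m⊔n≤o⇒m≤o (suc (suc i)) (support w) le) bal
... | bal' , sign-iw =
  bal' , trans sign-iw (trans (cong not sign-w) (BoolP.not-distribˡ-xor (odd (length w)) (sign (range N))))

equiv-parity : ∀ T w w' → Equiv T w w' → odd (length w) ≡ odd (length w')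
equiv-parity T w w' eq = xor-cancelʳ (sign (range N)) same-sign
  where
  N = support w ⊔ support w'
  same-sign : odd (length w) xor sign (range N) ≡ odd (length w') xor sign (range N)
  same-sign = trans (sym (proj₂ (word-sign T w N (ℕP.m≤m⊔n (support w) (support w')))))
                 (trans (cong sign (ListP.map-cong eq (range N)))
                        (proj₂ (word-sign T w' N (ℕP.m≤n⊔m (support w) (support w')))))
  xor-cancelʳ : ∀ c {a b} → a xor c ≡ b xor c → a ≡ b
  xor-cancelʳ c {a} {b} h = trans (sym (xor-twice a)) (trans (cong (_xor c) h) (xor-twice b))
    where
    xor-twice : ∀ x → (x xor c) xor c ≡ x
    xor-twice x = trans (BoolP.xor-assoc x c c) (trans (cong (x xor_) (BoolP.xor-same c)) (BoolP.xor-identityʳ x))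

actW-++ : ∀ T w v x → actW T (w ++ v) x ≡ actW T w (actW T v x)
actW-++ T []      v x = refl
actW-++ T (i ∷ w) v x = cong (genAct T i) (actW-++ T w v x)

Equiv-cons : ∀ {T w w'} i → Equiv T w w' → Equiv T (i ∷ w) (i ∷ w')
Equiv-cons {T} i e x = cong (genAct T i) (e x)

Equiv-snoc : ∀ {T w w'} i → Equiv T w w' → Equiv T (w ++ [ i ]) (w' ++ [ i ])
Equiv-snoc {T} {w} {w'} i e x =
  trans (actW-++ T w [ i ] x) (trans (e (genAct T i x)) (sym (actW-++ T w' [ i ] x)))

¬¬-length : ∀ T w → ¬ ¬ Σ ℕ (IsLen T w)
¬¬-length T w = do
  (m , represented , minimal) ← ¬¬-least (λ m → Σ (List ℕ) λ w' → Equiv T w' w × length w' ≡ m)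
                                         (length w) (w , (λ x → refl) , refl)
  pure (m , represented , λ w' e → minimal (length w') (w' , e , refl))

IsLen-transport : ∀ {T w w' n} → IsLen T w n → Equiv T w w' → IsLen T w' n
IsLen-transport ((v , e , len) , minimal) f =
  (v , (λ x → trans (e x) (f x)) , len) , λ w'' g → minimal w'' (λ x → trans (g x) (sym (f x)))

-- Multiplying by a generator on either side changes the length, since it
-- changes the parity of the length.
odd-snoc : ∀ n → odd (n ℕ.+ 1) ≡ not (odd n)
odd-snoc zero    = refl
odd-snoc (suc n) = cong not (odd-snoc n)

length-cons-≢ : ∀ {T w i n m} → IsLen T w n → IsLen T (i ∷ w) m → m ≢ n
length-cons-≢ {T} {w} {i} ((w₁ , e₁ , refl) , _) ((w₂ , e₂ , refl) , _) m≡n =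
  BoolP.not-¬ (cong odd m≡n) (sym (equiv-parity T (i ∷ w₁) w₂ (λ x → trans (Equiv-cons {T} {w₁} {w} i e₁ x) (sym (e₂ x)))))

length-snoc-≢ : ∀ {T w i n m} → IsLen T w n → IsLen T (w ++ [ i ]) m → m ≢ n
length-snoc-≢ {T} {w} {i} ((w₁ , e₁ , refl) , _) ((w₂ , e₂ , refl) , _) m≡n =
  BoolP.not-¬ (cong odd m≡n) (sym odd-w₂)
  where
  odd-w₂ : not (odd (length w₁)) ≡ odd (length w₂)
  odd-w₂ = trans (sym (odd-snoc (length w₁)))
    (trans (cong odd (sym (ListP.length-++ w₁)))
           (equiv-parity T (w₁ ++ [ i ]) w₂ (λ x → trans (Equiv-snoc {T} {w₁} {w} i e₁ x) (sym (e₂ x)))))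

genAct-suc : ∀ T k x → genAct T (suc k) x ≡ genAct B (suc k) x
genAct-suc B k x = refl
genAct-suc C k x = refl
genAct-suc D k x = refl

actW-A : ∀ T u x → actW T (map suc u) x ≡ actW B (map suc u) x
actW-A T []      x = refl
actW-A T (k ∷ u) x = trans (genAct-suc T k _) (cong (genAct B (suc k)) (actW-A T u x))

EquivA⇒Equiv : ∀ T u u' → EquivA u u' → Equiv T (map suc u) (map suc u')
EquivA⇒Equiv T u u' e x = trans (actW-A T u x) (trans (e x) (sym (actW-A T u' x)))

abs-sign-injective : ∀ {x y : ℤ} → ∣ x ∣ ≡ ∣ y ∣ → isNeg x ≡ isNeg y → x ≡ y
abs-sign-injective {+ a}      {+ b}      h _ = cong +_ h
abs-sign-injective { -[1+ a ]} { -[1+ b ]} h _ = cong -[1+_] (ℕP.suc-injective h)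
abs-sign-injective {+ a}      { -[1+ b ]} _ ()
abs-sign-injective { -[1+ a ]} {+ b}      _ ()

actW-A-sign : ∀ u x → isNeg (actW B (map suc u) x) ≡ isNeg x
actW-A-sign []      x = refl
actW-A-sign (k ∷ u) x =
  trans (SignedAction.sign-act (transpositionAction k) (actW B (map suc u) x))
        (trans (BoolP.xor-identityʳ _) (actW-A-sign u x))

transposition-involutive : ∀ T k x → genAct T (suc k) (genAct T (suc k) x) ≡ x
transposition-involutive T k x rewrite genAct-suc T k (genAct T (suc k) x) | genAct-suc T k x =
  abs-sign-injective
    (trans (abs-act (mapAbs (swN (suc k)) x)) (trans (cong σ (abs-act x)) (swN-involutive (suc k) ∣ x ∣)))
    (actW-A-sign (k ∷ k ∷ []) x)
  where open SignedAction (transpositionAction k)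

absWord : Typ → List ℕ → ℕ → ℕ
absWord T []      n = n
absWord T (i ∷ w) n = SignedAction.σ (genAction T i) (absWord T w n)

abs-actW : ∀ T w x → ∣ actW T w x ∣ ≡ absWord T w ∣ x ∣
abs-actW T []      x = refl
abs-actW T (i ∷ w) x = trans (SignedAction.abs-act (genAction T i) _) (cong (SignedAction.σ (genAction T i)) (abs-actW T w x))

-- Forgetting signs: a word in s₁, s₂, … (letter k standing for s_{k+1})
-- inducing the same permutation of absolute values; s₀ is dropped in types
-- B, C and s_{1̂} becomes s₁ in type D.
dropS₀ : List ℕ → List ℕ
dropS₀ []          = []
dropS₀ (zero ∷ w)  = dropS₀ w
dropS₀ (suc k ∷ w) = k ∷ dropS₀ w

forgetSigns : Typ → List ℕ → List ℕ
forgetSigns B w = dropS₀ w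
forgetSigns C w = dropS₀ w
forgetSigns D w = map ℕ.pred w

absWord-forgetSigns : ∀ T w n → absWord T w n ≡ absWord B (map suc (forgetSigns T w)) n
absWord-forgetSigns B []          n = refl
absWord-forgetSigns B (zero ∷ w)  n = absWord-forgetSigns B w n
absWord-forgetSigns B (suc k ∷ w) n = cong (swN (suc k)) (absWord-forgetSigns B w n)
absWord-forgetSigns C []          n = refl
absWord-forgetSigns C (zero ∷ w)  n = absWord-forgetSigns C w n
absWord-forgetSigns C (suc k ∷ w) n = cong (swN (suc k)) (absWord-forgetSigns C w n)
absWord-forgetSigns D []          n = refl
absWord-forgetSigns D (zero ∷ w)  n = cong (swN 1) (absWord-forgetSigns D w n)
absWord-forgetSigns D (suc k ∷ w) n = cong (swN (suc k)) (absWord-forgetSigns D w n)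

length-forgetSigns : ∀ T w → length (forgetSigns T w) ≤ length w
length-forgetSigns B w = length-dropS₀ w
  where
  length-dropS₀ : ∀ w → length (dropS₀ w) ≤ length w
  length-dropS₀ []          = z≤n
  length-dropS₀ (zero ∷ w)  = ℕP.m≤n⇒m≤1+n (length-dropS₀ w)
  length-dropS₀ (suc k ∷ w) = s≤s (length-dropS₀ w)
length-forgetSigns C w = length-forgetSigns B w
length-forgetSigns D w = ℕP.≤-reflexive (ListP.length-map ℕ.pred w)

forgetSigns-Equiv : ∀ T w u → Equiv T w (map suc u) → EquivA (forgetSigns T w) u
forgetSigns-Equiv T w u e x = abs-sign-injective
  (trans (abs-actW B (map suc (forgetSigns T w)) x) (trans (sym (absWord-forgetSigns T w ∣ x ∣))
    (trans (sym (abs-actW T w x)) (cong ∣_∣ (trans (e x) (actW-A T u x))))))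
  (trans (actW-A-sign (forgetSigns T w) x) (sym (actW-A-sign u x)))

IsLen⇒IsLenA : ∀ T u n → IsLen T (map suc u) n → IsLenA u n
IsLen⇒IsLenA T u n ((w , e , refl) , minimal) =
  (forgetSigns T w , forgetSigns-Equiv T w u e ,
   ℕP.≤-antisym (length-forgetSigns T w)
     (subst (length w ≤_) (ListP.length-map suc (forgetSigns T w))
            (minimal (map suc (forgetSigns T w)) (EquivA⇒Equiv T (forgetSigns T w) u (forgetSigns-Equiv T w u e))))) ,
  λ u' e' → subst (length w ≤_) (ListP.length-map suc u') (minimal (map suc u') (EquivA⇒Equiv T u' u e'))

-- An adjacent transposition s_{k+1} acts on the t's by multiplication on
-- the left (operator δ) and on the z's by multiplication on the right (∂).
data Side : Set where
  left right : Side

neighbour : Side → ℕ → List ℕ → List ℕ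
neighbour left  k w = suc k ∷ w
neighbour right k w = w ++ [ suc k ]

neighbourA : Side → ℕ → List ℕ → List ℕ
neighbourA left  k u = k ∷ u
neighbourA right k u = u ++ [ k ]

swapSide : Side → ℕ → Series → Series
swapSide left  = swapT
swapSide right = swapZ

-- the divisor of the type-A divided difference: α_{k+1}, resp. ω(α_{k+1})
root : Side → ℕ → Series
root left  k = tv (suc k) ⊖ tv k
root right k = zv k ⊖ zv (suc k)

neighbour-map-suc : ∀ side k u → neighbour side k (map suc u) ≡ map suc (neighbourA side k u)
neighbour-map-suc left  k u = refl
neighbour-map-suc right k u = sym (ListP.map-++ suc u [ k ])

neighbour-Equiv : ∀ {T w w'} side k → Equiv T w w' → Equiv T (neighbour side k w) (neighbour side k w')
neighbour-Equiv {T} {w} {w'} left  k = Equiv-cons {T} {w} {w'} (suc k)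
neighbour-Equiv {T} {w} {w'} right k = Equiv-snoc {T} {w} {w'} (suc k)

-- Since s_{k+1} is an involution, a neighbour can be moved to the other side.
neighbour-cancel : ∀ {T w v} side k → Equiv T (neighbour side k w) v → Equiv T w (neighbour side k v)
neighbour-cancel {T} {w} {v} left k e x =
  trans (sym (transposition-involutive T k (actW T w x))) (cong (genAct T (suc k)) (e x))
neighbour-cancel {T} {w} {v} right k e x =
  trans (cong (actW T w) (sym (transposition-involutive T k x)))
  (trans (sym (actW-++ T w [ suc k ] (genAct T (suc k) x)))
  (trans (e (genAct T (suc k) x)) (sym (actW-++ T v [ suc k ] x))))

length-neighbour-≢ : ∀ {T w n m} side k → IsLen T w n → IsLen T (neighbour side k w) m → m ≢ n
length-neighbour-≢ {T} {w} left  k = length-cons-≢ {T} {w} {suc k}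
length-neighbour-≢ {T} {w} right k = length-snoc-≢ {T} {w} {suc k}

-- Descent f f' along s_{k+1} on a side, between an element of length n with
-- value f and its neighbour of length m with value f': the defining
-- recursion of (double) Schubert polynomials, evaluated at x = 0.
Descent : Side → ℕ → ℕ → ℕ → Series → Series → Set
Descent side k n m f f' =
  (m < n → f ⊖ swapSide side k f ≈₀ root side k ⊛ f') × (n < m → f ≈₀ swapSide side k f)

same-differences : ∀ {f g f' g' n m} side k → m ≢ n → (m < n → f' ≈₀ g') →
  Descent side k n m f f' → Descent side k n m g g' →
  f ⊖ swapSide side k f ≈₀ g ⊖ swapSide side k g
same-differences {f} {g} {f'} {g'} {n} {m} side k m≢n shorter (f-down , f-up) (g-down , g-up) with ℕP.<-cmp m n
... | tri< m<n _ _ = λ a b →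
  trans (f-down m<n a b)
    (trans (⊛-cong₀ {root side k} {root side k} {f'} {g'} (λ _ _ → refl) (shorter m<n) a b) (sym (g-down m<n a b)))
... | tri≈ _ m≡n _ = ⊥-elim (m≢n m≡n)
... | tri> _ _ n<m = λ a b →
  trans (ℤP.i≡j⇒i-j≡0 {f a b []} {swapSide side k f a b []} (f-up n<m a b))
        (sym (ℤP.i≡j⇒i-j≡0 {g a b []} {swapSide side k g a b []} (g-up n<m a b)))

st-suc : ∀ T k f → st T (suc k) f ≡ swapT k f
st-suc B k f = refl
st-suc C k f = refl
st-suc D k f = refl

sz-suc : ∀ T k f → sz T (suc k) f ≡ swapZ k f
sz-suc B k f = refl
sz-suc C k f = refl
sz-suc D k f = refl

alpha-suc : ∀ T k → alpha T (suc k) ≡ tv (suc k) ⊖ tv k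
alpha-suc B k = refl
alpha-suc C k = refl
alpha-suc D k = refl

omega-root : ∀ k → omegaS (tv (suc k) ⊖ tv k) ≈₀ zv k ⊖ zv (suc k)
omega-root k x y with allZero x in x≡0 | isUnit k y in y≡z₍ₖ₎ | isUnit (suc k) y in y≡z₍ₖ₊₁₎
... | false | false | false = ℤP.*-zeroʳ (sgn (sumL x ℕ.+ sumL y))
... | false | false | true  = ℤP.*-zeroʳ (sgn (sumL x ℕ.+ sumL y))
... | false | true  | false = ℤP.*-zeroʳ (sgn (sumL x ℕ.+ sumL y))
... | false | true  | true  = ℤP.*-zeroʳ (sgn (sumL x ℕ.+ sumL y))
... | true  | false | false = ℤP.*-zeroʳ (sgn (sumL x ℕ.+ sumL y))
... | true  | false | true  rewrite allZero⇒sum≡0 x x≡0 | isUnit-sum (suc k) y y≡z₍ₖ₊₁₎ = refl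
... | true  | true  | q     rewrite allZero⇒sum≡0 x x≡0 | isUnit-sum k y y≡z₍ₖ₎ = negate q
  where
  negate : ∀ q → ℤ.- 1ℤ ℤ.* ((if q ∧ true then 1ℤ else 0ℤ) ℤ.- 1ℤ) ≡ 1ℤ ℤ.- (if q ∧ true then 1ℤ else 0ℤ)
  negate false = refl
  negate true  = refl

S-descent : ∀ {T S} → IsDoubleSchubert T S → ∀ side k {w n m} →
  IsLen T w n → IsLen T (neighbour side k w) m → Descent side k n m (S w) (S (neighbour side k w))
S-descent {T} {S} hS left k {w} {n} {m} len len' =
  (λ m<n → subst₂ (λ σ α → S w ⊖ σ ≈₀ α ⊛ S (suc k ∷ w)) (st-suc T k (S w)) (alpha-suc T k)
                  (λ a b → proj₁ δ-law m<n a b [])) ,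
  (λ n<m → subst (S w ≈₀_) (st-suc T k (S w)) (λ a b → proj₂ δ-law n<m a b []))
  where δ-law = IsDoubleSchubert.delta hS w (suc k) m n len len'
S-descent {T} {S} hS right k {w} {n} {m} len len' =
  (λ m<n a b → trans (cong (λ σ → (S w ⊖ σ) a b []) (sym (sz-suc T k (S w))))
                (trans (proj₁ ∂-law m<n a b [])
                       (⊛-cong₀ {omegaS (alpha T (suc k))} {root right k} {S w'} {S w'}
                                (subst (λ α → omegaS α ≈₀ root right k) (sym (alpha-suc T k)) (omega-root k))
                                (λ _ _ → refl) a b))) ,
  (λ n<m → subst (S w ≈₀_) (sz-suc T k (S w)) (λ a b → proj₂ ∂-law n<m a b []))
  where
  w' = w ++ [ suc k ]
  ∂-law = IsDoubleSchubert.partial hS w (suc k) m n len len'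

SA-descent : ∀ {SA} → IsDoubleSchubertA SA → ∀ side k {u n m} →
  IsLenA u n → IsLenA (neighbourA side k u) m → Descent side k n m (SA u) (SA (neighbourA side k u))
SA-descent hA left  k {u} {n} {m} len len' =
  (λ m<n a b → proj₁ δ-law m<n a b []) , (λ n<m a b → proj₂ δ-law n<m a b [])
  where δ-law = IsDoubleSchubertA.delta hA u k m n len len'
SA-descent hA right k {u} {n} {m} len len' =
  (λ m<n a b → proj₁ ∂-law m<n a b []) , (λ n<m a b → proj₂ ∂-law n<m a b [])
  where ∂-law = IsDoubleSchubertA.partial hA u k m n len len'

zeroS≡0 : ∀ a b c → zeroS a b c ≡ 0ℤ
zeroS≡0 a b c with allZero a ∧ allZero b ∧ allZero c
... | true  = refl
... | false = refl

swapSide-zeroS : ∀ side k a b → swapSide side k zeroS a b [] ≡ 0ℤ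
swapSide-zeroS left  k a b = zeroS≡0 (swapL a k (suc k)) b []
swapSide-zeroS right k a b = zeroS≡0 a (swapL b k (suc k)) []

zero-descent : ∀ side k n m → Descent side k n m zeroS zeroS
zero-descent side k n m =
  (λ _ a b → trans (cong₂ ℤ._-_ (zeroS≡0 a b []) (swapSide-zeroS side k a b)) (sym (root-⊛-zero a b))) ,
  (λ _ a b → trans (zeroS≡0 a b []) (sym (swapSide-zeroS side k a b)))
  where
  root-⊛-zero : ∀ a b → (root side k ⊛ zeroS) a b [] ≡ 0ℤ
  root-⊛-zero a b = ⊛-vanishes (root side k) zeroS a b []
    (λ a₁ a₂ b₁ b₂ c₁ c₂ _ _ _ → trans (cong (root side k a₁ b₁ c₁ ℤ.*_) (zeroS≡0 a₂ b₂ c₂))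
                                       (ℤP.*-zeroʳ (root side k a₁ b₁ c₁)))

module Comparison {T : Typ} {S : List ℕ → Series} (hS : IsDoubleSchubert T S)
  (Target : List ℕ → Series → Set)
  (target-poly : ∀ {w g} → Target w g → InPoly g)
  (target-constant : ∀ {w g} → Target w g → S w [] [] [] ≡ g [] [] [])
  (target-descent : ∀ side k {w g n m} → Target w g → IsLen T w n → IsLen T (neighbour side k w) m →
                      Σ Series λ g' → Target (neighbour side k w) g' × Descent side k n m g g')
  where
  open IsDoubleSchubert hS using (inR)

  agrees-at-length : ∀ n {w g} → IsLen T w n → Target w g → S w ≈₀ g
  agrees-at-length = <-rec _ step
    where
    step : ∀ n → (∀ {m} → m < n → ∀ {w g} → IsLen T w m → Target w g → S w ≈₀ g) →
           ∀ {w g} → IsLen T w n → Target w g → S w ≈₀ g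
    -- (a polynomial candidate is viewed in R of type B; any type would do)
    step n shorter {w} {g} len target =
      agree-at-zero (proj₂ (bounded-R (inR w))) (proj₂ (bounded-R (poly⇒R {B} (target-poly target))))
        (constantStable-R (inR w)) (constantStable-R (poly⇒R {B} (target-poly target)))
        (target-constant target) (differences left) (differences right)
      where
      differences : ∀ side k a b → ¬ ¬ ((S w ⊖ swapSide side k (S w)) a b [] ≡ (g ⊖ swapSide side k g) a b [])
      differences side k a b = do
        (m , len') ← ¬¬-length T (neighbour side k w)
        let (g' , target' , g-descent) = target-descent side k target len len'
        pure (same-differences {S w} {g} {S (neighbour side k w)} {g'} {n} {m} side k
                (length-neighbour-≢ side k len len')
                (λ m<n → shorter m<n len' target') (S-descent hS side k len len') g-descent a b)

  agrees : ∀ {w g} → Target w g → S w ≈₀ g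
  agrees {w} target a b = stableℤ (do
    (n , len) ← ¬¬-length T w
    pure (agrees-at-length n len target a b))

restricts-to-A : ∀ {T S SA} → IsDoubleSchubert T S → IsDoubleSchubertA SA →
  ∀ w u → Equiv T w (map suc u) → S w ≈₀ SA u
restricts-to-A {T} {S} {SA} hS hA w u e =
  Comparison.agrees hS Target (λ { (u , _ , refl) → inPoly u }) target-constant target-descent (u , e , refl)
  where
  open IsDoubleSchubertA hA using (inPoly)
  Target : List ℕ → Series → Set
  Target w g = Σ (List ℕ) λ u → Equiv T w (map suc u) × SA u ≡ g

  -- both constant terms are 1 at the identity and 0 elsewhere
  target-constant : ∀ {w g} → Target w g → S w [] [] [] ≡ g [] [] []
  target-constant {w} (u , e , refl) = stableℤ (¬¬-excluded-middle {A = Equiv T w []} >>= λ where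
    (yes w∼e) → pure (trans (IsDoubleSchubert.wellDef hS w [] w∼e [] [] [])
                     (trans (IsDoubleSchubert.unit hS [] [] [])
                     (sym (trans (IsDoubleSchubertA.wellDef hA u [] (u∼e w∼e) [] [] [])
                                 (IsDoubleSchubertA.unit hA [] [] [])))))
    (no w≁e)  → pure (trans (IsDoubleSchubert.constTm hS w w≁e)
                     (sym (IsDoubleSchubertA.constTm hA u (λ u∼e → w≁e (w∼e u∼e))))))
    where
    u∼e : Equiv T w [] → EquivA u []
    u∼e w∼e x = trans (sym (actW-A T u x)) (trans (sym (e x)) (w∼e x))
    w∼e : EquivA u [] → Equiv T w []
    w∼e u∼e x = trans (e x) (trans (actW-A T u x) (u∼e x))

  target-descent : ∀ side k {w g n m} → Target w g → IsLen T w n → IsLen T (neighbour side k w) m →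
                     Σ Series λ g' → Target (neighbour side k w) g' × Descent side k n m g g'
  target-descent side k {w} {n = n} {m} (u , e , refl) len len' =
    SA u' , (u' , e' , refl) ,
    SA-descent hA side k 
      (IsLen⇒IsLenA T u n (IsLen-transport {T} {w} {map suc u} len e))
      (IsLen⇒IsLenA T u' m (IsLen-transport {T} {neighbour side k w} {map suc u'} len' e'))
    where
    u' = neighbourA side k u
    e' : Equiv T (neighbour side k w) (map suc u')
    e' = subst (Equiv T (neighbour side k w)) (neighbour-map-suc side k u) (neighbour-Equiv side k e)

-- For w ∉ S_∞ the candidate is 0; every neighbour of w lies outside S_∞ too.
vanishes-off-A : ∀ {T S} → IsDoubleSchubert T S →
  ∀ w → (∀ u → ¬ Equiv T w (map suc u)) → S w ≈₀ zeroS
vanishes-off-A {T} {S} hS w outside =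
  Comparison.agrees hS Target (λ { (_ , refl) → cst 0ℤ })
    (λ { {w} (outside , refl) → IsDoubleSchubert.constTm hS w (outside []) })
    target-descent (outside , refl)
  where
  Target : List ℕ → Series → Set
  Target w g = (∀ u → ¬ Equiv T w (map suc u)) × zeroS ≡ g

  target-descent : ∀ side k {w g n m} → Target w g → IsLen T w n → IsLen T (neighbour side k w) m →
                     Σ Series λ g' → Target (neighbour side k w) g' × Descent side k n m g g'
  target-descent side k {w} {n = n} {m} (outside , refl) _ _ =
    zeroS , (outside' , refl) , zero-descent side k n m
    where
    outside' : ∀ u → ¬ Equiv T (neighbour side k w) (map suc u)
    outside' u e = outside (neighbourA side k u)
      (subst (Equiv T w) (neighbour-map-suc side k u) (neighbour-cancel side k e))

lemma8p3 : (T : Typ) (S : List ℕ → Series) (SA : List ℕ → Series) →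
    IsDoubleSchubert T S → IsDoubleSchubertA SA →
    ((w u : List ℕ) → Equiv T w (map suc u) → spec (S w) ≈ SA u)
    × ((w : List ℕ) → (∀ u → ¬ Equiv T w (map suc u)) → spec (S w) ≈ zeroS)
lemma8p3 T S SA hS hA = in-S∞ , outside-S∞
  where
  -- spec (S w) only depends on S w at x = 0, and spec fixes polynomials in t, z.
  in-S∞ : ∀ w u → Equiv T w (map suc u) → spec (S w) ≈ SA u
  in-S∞ w u e a b c = trans (spec-cong₀ {S w} {SA u} (restricts-to-A hS hA w u e) a b c)
                            (spec-poly (IsDoubleSchubertA.inPoly hA u) a b c)
  outside-S∞ : ∀ w → (∀ u → ¬ Equiv T w (map suc u)) → spec (S w) ≈ zeroS
  outside-S∞ w outside a b c = trans (spec-cong₀ {S w} {zeroS} (vanishes-off-A hS w outside) a b c)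
                                     (spec-poly (cst 0ℤ) a b c)
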